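{- Let $k\ge 2$ be an integer and let $\theta_k\in S_k$ be the permutation whose one-line notation is $k\,1\,2\,\cdots\,(k-2)\,(k-1)$. Then for every $n\geq k$, $$\langle S_n(132,231,321,\theta_k)\rangle\cong S_{k-1}.$$
   Context: $S_n$ is the symmetric group on $[n]$, permutations written in one-line notation. A permutation $\pi\in S_n$ contains the pattern $\tau\in S_m$ if some subsequence of $\pi$ of length $m$ is order-isomorphic to $\tau$; otherwise it avoids $\tau$. $S_n(\tau_1,\dots,\tau_j)$ is the set of permutations in $S_n$ avoiding each $\tau_i$, and $\langle A\rangle$ is the subgroup of $S_n$ generated by $A$. -}

module Defs where

open import Data.Nat using (ℕ; zero; suc; _∸_)
open import Data.Fin using (Fin; zero; suc; fromℕ; inject₁; _<_)
open import Data.Fin.Permutation using (Permutation′; _⟨$⟩ʳ_; _∘ₚ_; flip; id; _≈_)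
open import Data.Product using (Σ; ∃; _×_; _,_; proj₁)
open import Relation.Nullary using (¬_)
open import Function.Bundles using (_⇔_)

-- A pattern is given in one-line notation as a map Fin m → Fin m
-- (position ↦ value, 0-based).  A permutation π ∈ S_n, as a bijection
-- Fin n ↔ Fin n, has one-line notation i ↦ π ⟨$⟩ʳ i.

Contains : ∀ {n m} → Permutation′ n → (Fin m → Fin m) → Set
Contains {n} {m} π τ =
  Σ (Fin m → Fin n) λ f →
    (∀ i j → i < j → f i < f j) ×
    (∀ i j → ((π ⟨$⟩ʳ f i) < (π ⟨$⟩ʳ f j)) ⇔ (τ i < τ j))

Avoids : ∀ {n m} → Permutation′ n → (Fin m → Fin m) → Set
Avoids π τ = ¬ Contains π τ

p132 p231 p321 : Fin 3 → Fin 3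
p132 zero = zero
p132 (suc zero) = suc (suc zero)
p132 (suc (suc zero)) = suc zero
p231 zero = suc zero
p231 (suc zero) = suc (suc zero)
p231 (suc (suc zero)) = zero
p321 zero = suc (suc zero)
p321 (suc zero) = suc zero
p321 (suc (suc zero)) = zero

-- θ_k = k 1 2 ⋯ (k-1) in one-line notation (0-based: k-1, 0, 1, …, k-2).
θ : (k : ℕ) → Fin k → Fin k
θ (suc j) zero = fromℕ j
θ (suc j) (suc i) = inject₁ i

-- Membership in the subgroup ⟨A⟩ of S_n generated by a set A
-- (given as a predicate); permutations are compared pointwise.
data Gen {n : ℕ} (A : Permutation′ n → Set) : Permutation′ n → Set where
  gen  : ∀ {σ} → A σ → Gen A σ
  one  : Gen A id
  mul  : ∀ {σ τ} → Gen A σ → Gen A τ → Gen A (σ ∘ₚ τ)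
  inv  : ∀ {σ} → Gen A σ → Gen A (flip σ)
  resp : ∀ {σ τ} → σ ≈ τ → Gen A σ → Gen A τ

record IsoToSym {n : ℕ} (A : Permutation′ n → Set) (m : ℕ) : Set where
  field
    φ       : Σ (Permutation′ n) (Gen A) → Permutation′ m
    φ-cong  : ∀ {x y} → proj₁ x ≈ proj₁ y → φ x ≈ φ y
    φ-hom   : ∀ {σ τ} (p : Gen A σ) (q : Gen A τ) →
              φ (σ ∘ₚ τ , mul p q) ≈ (φ (σ , p) ∘ₚ φ (τ , q))
    φ-inj   : ∀ x y → φ x ≈ φ y → proj₁ x ≈ proj₁ y
    φ-surj  : ∀ ρ → ∃ λ x → φ x ≈ ρ

Avoiders : (n k : ℕ) → Permutation′ n → Set
Avoiders n k π = Avoids π p132 × Avoids π p231 × Avoids π p321 × Avoids π (θ k)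

{-# OPTIONS --safe #-}
-- Avoiding 132, 231 and 321 forces a permutation to increase after its first entry a; deleting
-- that entry leaves an increasing, hence identity, permutation, so it is the cycle
-- 0 ↦ a ↦ a-1 ↦ ⋯ ↦ 1 ↦ 0. Such a cycle contains θ_k exactly when a ≥ k-1 (the entries
-- a, 0, 1, …, k-2 form the pattern), so the avoiders are the cycles with a < k-1. These fix every
-- point ≥ k-1, and they generate every permutation σ that does: if σ moves no point above J, then
-- (cycle J)⁻¹ followed by cycle (σ J) lies in the group and sends J through 0 to σ J, so dividing
-- it out of σ fixes J as well.
-- Finally, the pointwise stabiliser of {k-1, …, n-1} in S_n is a copy of S_{k-1}.

module Submission where

open import Defs
open import Data.Nat using (ℕ; _≤_; _∸_)
open import Data.Nat.Base as ℕ using (zero; suc; _+_; z≤n; s≤s; z<s; s<s)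
import Data.Nat.Properties as ℕ
open import Data.Fin.Base
  using (Fin; zero; suc; toℕ; fromℕ; fromℕ<; inject₁; inject≤; punchIn; _↑ˡ_; splitAt; join; _<_)
open import Data.Fin.Patterns using (0F; 1F; 2F)
open import Data.Fin.Properties
  using ( toℕ-injective; toℕ<n; toℕ-fromℕ; toℕ-fromℕ<; toℕ-inject₁; toℕ-inject≤; ≤fromℕ; ≤̄⇒inject₁<
        ; inject₁-injective; fromℕ≢inject₁; <-cmp; <⇒≢; punchIn-mono-≤; punchIn-cancel-≤
        ; toℕ-↑ˡ; toℕ-↑ʳ; ↑ˡ-injective; splitAt-↑ˡ; splitAt-≥; splitAt⁻¹-↑ˡ; splitAt⁻¹-↑ʳ; join-splitAt; +↔⊎)
open import Data.Fin.Permutation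
  using ( Permutation′; _⟨$⟩ʳ_; _⟨$⟩ˡ_; _∘ₚ_; flip; id; _≈_; inverseˡ; inverseʳ; permutation
        ; insert; remove; punchIn-permute)
open import Data.Vec.Functional using ([]; _∷_)
open import Data.Empty using (⊥; ⊥-elim)
open import Data.Product using (Σ; _,_; proj₁)
open import Data.Sum using (_⊎_; inj₁; inj₂; map₁)
open import Data.Sum.Function.Propositional using (_⊎-↔_)
open import Function using (_∘_; Injection)
open import Function.Bundles using (_⇔_; mk⇔; Equivalence)
open import Function.Construct.Composition using (_↔-∘_)
open import Function.Construct.Identity using (↔-id)
open import Function.Construct.Symmetry using (↔-sym)
open import Function.Definitions using (Injective)
open import Function.Properties.Inverse using (↔⇒↣)
open import Relation.Binary.Definitions using (Monotonic₁; tri<; tri≈; tri>)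
open import Relation.Binary.PropositionalEquality
  using (_≡_; refl; sym; trans; cong; subst; subst₂; module ≡-Reasoning)
open import Relation.Nullary using (contradiction)

⟨$⟩ʳ-injective : ∀ {n} (σ : Permutation′ n) → Injective _≡_ _≡_ (σ ⟨$⟩ʳ_)
⟨$⟩ʳ-injective σ = Injection.injective (↔⇒↣ σ)

inject₁-mono-< : ∀ {n} {i j : Fin n} → i < j → inject₁ i < inject₁ j
inject₁-mono-< {i = i} {j} = subst₂ ℕ._<_ (sym (toℕ-inject₁ i)) (sym (toℕ-inject₁ j))

increasing-cancel-< : ∀ {m n} {f : Fin m → Fin n} → Monotonic₁ _<_ _<_ f →
                      ∀ {i j} → f i < f j → i < j
increasing-cancel-< f-inc {i} {j} fi<fj with <-cmp i j
... | tri< i<j _ _ = i<j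
... | tri≈ _ refl _ = contradiction fi<fj (ℕ.<-irrefl refl)
... | tri> _ _ j<i = contradiction fi<fj (ℕ.<-asym (f-inc j<i))

increasing⇒inflationary : ∀ {m n} (f : Fin m → Fin n) → Monotonic₁ _<_ _<_ f →
                          ∀ i → toℕ i ≤ toℕ (f i)
increasing⇒inflationary f f-inc zero    = z≤n
increasing⇒inflationary f f-inc (suc i) =
  ℕ.≤-<-trans (increasing⇒inflationary (f ∘ inject₁) (f-inc ∘ inject₁-mono-<) i)
              (f-inc (≤̄⇒inject₁< ℕ.≤-refl))

-- Both σ and its inverse are inflationary, so σ i ≤ σ⁻¹ (σ i) = i.
increasing-permutation≈id : ∀ {n} (σ : Permutation′ n) → Monotonic₁ _<_ _<_ (σ ⟨$⟩ʳ_) → σ ≈ id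
increasing-permutation≈id σ σ-inc i = toℕ-injective (ℕ.≤-antisym σi≤i i≤σi)
  where
  σ⁻¹-inc : Monotonic₁ _<_ _<_ (σ ⟨$⟩ˡ_)
  σ⁻¹-inc x<y = increasing-cancel-< σ-inc (subst₂ _<_ (sym (inverseʳ σ)) (sym (inverseʳ σ)) x<y)
  i≤σi : toℕ i ≤ toℕ (σ ⟨$⟩ʳ i)
  i≤σi = increasing⇒inflationary _ σ-inc i
  σi≤i : toℕ (σ ⟨$⟩ʳ i) ≤ toℕ i
  σi≤i = subst (λ x → toℕ (σ ⟨$⟩ʳ i) ≤ toℕ x) (inverseˡ σ) (increasing⇒inflationary _ σ⁻¹-inc (σ ⟨$⟩ʳ i))

increasing₃ : ∀ {n} {u v w : Fin n} → u < v → v < w → Monotonic₁ _<_ _<_ (u ∷ v ∷ w ∷ [])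
increasing₃ u<v v<w {0F} {1F} _ = u<v
increasing₃ u<v v<w {0F} {2F} _ = ℕ.<-trans u<v v<w
increasing₃ u<v v<w {1F} {2F} _ = v<w
increasing₃ u<v v<w {1F} {1F} (s<s ())
increasing₃ u<v v<w {2F} {2F} (s<s (s<s ()))

relabelling⇒Contains : ∀ {n m} (π : Permutation′ n) (τ : Fin m → Fin m) (f h : Fin m → Fin n) →
                       Monotonic₁ _<_ _<_ f → Monotonic₁ _<_ _<_ h →
                       (∀ i → π ⟨$⟩ʳ f i ≡ h (τ i)) → Contains π τ
relabelling⇒Contains π τ f h f-inc h-inc π∘f≗h∘τ = f , (λ _ _ → f-inc) , λ i j → mk⇔
  (λ πi<πj → increasing-cancel-< h-inc (subst₂ _<_ (π∘f≗h∘τ i) (π∘f≗h∘τ j) πi<πj))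
  (λ τi<τj → subst₂ _<_ (sym (π∘f≗h∘τ i)) (sym (π∘f≗h∘τ j)) (h-inc τi<τj))

order-preserving⇒Contains : ∀ {n m} (π : Permutation′ n) {τ : Fin m → Fin m} → Injective _≡_ _≡_ τ →
                            (f : Fin m → Fin n) → Monotonic₁ _<_ _<_ f →
                            (∀ {i j} → τ i < τ j → π ⟨$⟩ʳ f i < π ⟨$⟩ʳ f j) → Contains π τ
order-preserving⇒Contains π {τ} τ-inj f f-inc τ<⇒π< = f , (λ _ _ → f-inc) , λ i j → mk⇔ (π<⇒τ< i j) τ<⇒π<
  where
  π<⇒τ< : ∀ i j → π ⟨$⟩ʳ f i < π ⟨$⟩ʳ f j → τ i < τ j
  π<⇒τ< i j πi<πj with <-cmp (τ i) (τ j)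
  ... | tri< τi<τj _ _ = τi<τj
  ... | tri≈ _ τi≡τj _ = contradiction πi<πj (ℕ.<-irrefl (cong (λ x → toℕ (π ⟨$⟩ʳ f x)) (τ-inj τi≡τj)))
  ... | tri> _ _ τj<τi = contradiction πi<πj (ℕ.<-asym (τ<⇒π< τj<τi))

Contains-resp-≈ : ∀ {n m} {π ρ : Permutation′ n} {τ : Fin m → Fin m} → π ≈ ρ → Contains π τ → Contains ρ τ
Contains-resp-≈ {τ = τ} π≈ρ (f , f-inc , order) = f , f-inc , λ i j →
  subst₂ (λ x y → (x < y) ⇔ (τ i < τ j)) (π≈ρ (f i)) (π≈ρ (f j)) (order i j)

θ-injective : ∀ k → Injective _≡_ _≡_ (θ k)
θ-injective (suc m) {0F}    {0F}    _  = refl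
θ-injective (suc m) {0F}    {suc j} eq = contradiction eq fromℕ≢inject₁
θ-injective (suc m) {suc i} {0F}    eq = contradiction (sym eq) fromℕ≢inject₁
θ-injective (suc m) {suc i} {suc j} eq = cong suc (inject₁-injective eq)

-- One-line notation a 0 1 ⋯ (a-1) (a+1) ⋯ (n-1).
cycle : ∀ {n} → Fin (suc n) → Permutation′ (suc n)
cycle a = insert zero a id

punchIn-≥ : ∀ {n} (i : Fin (suc n)) (j : Fin n) → toℕ i ≤ toℕ j → punchIn i j ≡ suc j
punchIn-≥ zero    j       _         = refl
punchIn-≥ (suc i) (suc j) (s≤s i≤j) = cong suc (punchIn-≥ i j i≤j)

toℕ-punchIn-< : ∀ {n} (i : Fin (suc n)) (j : Fin n) → toℕ j ℕ.< toℕ i → toℕ (punchIn i j) ≡ toℕ j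
toℕ-punchIn-< (suc i) zero    _         = refl
toℕ-punchIn-< (suc i) (suc j) (s<s j<i) = cong suc (toℕ-punchIn-< i j j<i)

cycle-fixes : ∀ {n} (a : Fin (suc n)) {i} → toℕ a ℕ.< toℕ i → cycle a ⟨$⟩ʳ i ≡ i
cycle-fixes a {suc j} (s≤s a≤j) = punchIn-≥ a j a≤j

TailIncreasing : ∀ {n} → Permutation′ (suc n) → Set
TailIncreasing π = Monotonic₁ _<_ _<_ (λ j → π ⟨$⟩ʳ suc j)

cycle-TailIncreasing : ∀ {n} (a : Fin (suc n)) → TailIncreasing (cycle a)
cycle-TailIncreasing a {j} {l} j<l =
  ℕ.≰⇒> (λ pl≤pj → ℕ.<⇒≱ j<l (punchIn-cancel-≤ a l j pl≤pj))

TailIncreasing⇒≈cycle : ∀ {n} (π : Permutation′ (suc n)) → TailIncreasing π → π ≈ cycle (π ⟨$⟩ʳ zero)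
TailIncreasing⇒≈cycle π π-inc zero    = refl
TailIncreasing⇒≈cycle {n} π π-inc (suc j) = begin
  π ⟨$⟩ʳ suc j          ≡⟨ punchIn-permute π zero j ⟩
  punchIn a (π₀ ⟨$⟩ʳ j)  ≡⟨ cong (punchIn a) (increasing-permutation≈id π₀ π₀-inc j) ⟩
  punchIn a j           ∎
  where
  open ≡-Reasoning
  a : Fin (suc n)
  a = π ⟨$⟩ʳ zero
  π₀ : Permutation′ n
  π₀ = remove zero π
  π₀-inc : Monotonic₁ _<_ _<_ (π₀ ⟨$⟩ʳ_)
  π₀-inc {j} {l} j<l = ℕ.≰⇒> λ π₀l≤π₀j → ℕ.<⇒≱ (π-inc j<l)
    (subst₂ (λ x y → toℕ x ≤ toℕ y) (sym (punchIn-permute π zero l)) (sym (punchIn-permute π zero j))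
            (punchIn-mono-≤ a _ _ π₀l≤π₀j))

inversion-starts-at-zero : ∀ {n} (π : Permutation′ (suc n)) → TailIncreasing π →
                           ∀ {x y} → x < y → π ⟨$⟩ʳ y < π ⟨$⟩ʳ x → x ≡ zero
inversion-starts-at-zero π π-inc {zero}  _                 _     = refl
inversion-starts-at-zero π π-inc {suc _} {suc _} (s<s x<y) πy<πx =
  contradiction πy<πx (ℕ.<-asym (π-inc x<y))

TailIncreasing⇒avoids-descent : ∀ {n} (π : Permutation′ (suc n)) → TailIncreasing π →
                                (τ : Fin 3 → Fin 3) → τ 2F < τ 1F → Avoids π τ
TailIncreasing⇒avoids-descent π π-inc τ τ₂<τ₁ (f , f-inc , order) =
  ℕ.n≮0 (subst (λ x → toℕ (f 0F) ℕ.< toℕ x) f₁≡0 (f-inc 0F 1F z<s))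
  where
  f₁≡0 : f 1F ≡ zero
  f₁≡0 = inversion-starts-at-zero π π-inc (f-inc 1F 2F (s<s z<s)) (Equivalence.from (order 2F 1F) τ₂<τ₁)

avoids⇒TailIncreasing : ∀ {n} (π : Permutation′ (suc n)) →
                        Avoids π p132 → Avoids π p231 → Avoids π p321 → TailIncreasing π
avoids⇒TailIncreasing {n} π ¬132 ¬231 ¬321 {j} {l} j<l = y<z
  where
  x y z : Fin (suc n)
  x = π ⟨$⟩ʳ zero
  y = π ⟨$⟩ʳ suc j
  z = π ⟨$⟩ʳ suc l
  pattern-at : ∀ τ {u v w} → u < v → v < w →
               (∀ i → π ⟨$⟩ʳ (zero ∷ suc j ∷ suc l ∷ []) i ≡ (u ∷ v ∷ w ∷ []) (τ i)) → Contains π τ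
  pattern-at τ u<v v<w = relabelling⇒Contains π τ _ _ (increasing₃ z<s (s<s j<l)) (increasing₃ u<v v<w)
  no-descent : z < y → ⊥
  no-descent z<y with <-cmp x z | <-cmp x y
  ... | tri< x<z _ _ | _            = ¬132 (pattern-at p132 x<z z<y λ { 0F → refl ; 1F → refl ; 2F → refl })
  ... | tri≈ _ x≡z _ | _            = contradiction (⟨$⟩ʳ-injective π x≡z) λ ()
  ... | tri> _ _ z<x | tri< x<y _ _ = ¬231 (pattern-at p231 z<x x<y λ { 0F → refl ; 1F → refl ; 2F → refl })
  ... | tri> _ _ _   | tri≈ _ x≡y _ = contradiction (⟨$⟩ʳ-injective π x≡y) λ ()
  ... | tri> _ _ _   | tri> _ _ y<x = ¬321 (pattern-at p321 z<y y<x λ { 0F → refl ; 1F → refl ; 2F → refl })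
  y<z : y < z
  y<z with <-cmp y z
  ... | tri< y<z _ _ = y<z
  ... | tri≈ _ y≡z _ = contradiction (⟨$⟩ʳ-injective π y≡z) (<⇒≢ (s<s j<l))
  ... | tri> _ _ z<y = ⊥-elim (no-descent z<y)

Contains-θ⇒≤head : ∀ {n m} (π : Permutation′ (suc n)) → TailIncreasing π →
                   Contains π (θ (suc m)) → m ≤ toℕ (π ⟨$⟩ʳ zero)
Contains-θ⇒≤head {m = zero}  π π-inc _                     = z≤n
Contains-θ⇒≤head {n} {suc m} π π-inc (f , f-inc , order) =
  subst (λ x → suc m ≤ toℕ (π ⟨$⟩ʳ x)) f₀≡0 (begin-strict
    m                    ≡⟨ toℕ-fromℕ m ⟨
    toℕ (fromℕ m)        ≤⟨ increasing⇒inflationary tail tail-inc (fromℕ m) ⟩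
    toℕ (tail (fromℕ m)) <⟨ drop ⟩
    toℕ (π ⟨$⟩ʳ f 0F)    ∎)
  where
  open ℕ.≤-Reasoning
  tail : Fin (suc m) → Fin (suc n)
  tail i = π ⟨$⟩ʳ f (suc i)
  tail-inc : Monotonic₁ _<_ _<_ tail
  tail-inc i<j = Equivalence.from (order _ _) (inject₁-mono-< i<j)
  drop : tail (fromℕ m) < π ⟨$⟩ʳ f 0F
  drop = Equivalence.from (order _ 0F) (≤̄⇒inject₁< ℕ.≤-refl)
  f₀≡0 : f 0F ≡ zero
  f₀≡0 = inversion-starts-at-zero π π-inc (f-inc 0F (suc (fromℕ m)) z<s) drop

cycle-contains-θ : ∀ {n m} (a : Fin (suc n)) → m ≤ toℕ a → Contains (cycle a) (θ (suc m))
cycle-contains-θ {n} {m} a m≤a = order-preserving⇒Contains (cycle a) (θ-injective (suc m)) pos pos-inc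
                                   (λ {i} {j} → θ<⇒< {i} {j})
  where
  m<n : suc m ≤ suc n
  m<n = ℕ.<-≤-trans (s≤s m≤a) (toℕ<n a)
  pos : Fin (suc m) → Fin (suc n)
  pos i = inject≤ i m<n
  pos-inc : Monotonic₁ _<_ _<_ pos
  pos-inc {i} {j} = subst₂ ℕ._<_ (sym (toℕ-inject≤ i m<n)) (sym (toℕ-inject≤ j m<n))
  value : ∀ j → toℕ (cycle a ⟨$⟩ʳ pos (suc j)) ≡ toℕ j
  value j = trans (toℕ-punchIn-< a _ (ℕ.<-≤-trans (subst (ℕ._< m) (sym (toℕ-inject≤ j _)) (toℕ<n j)) m≤a))
                  (toℕ-inject≤ j _)
  θ<⇒< : ∀ {i j} → θ (suc m) i < θ (suc m) j → cycle a ⟨$⟩ʳ pos i < cycle a ⟨$⟩ʳ pos j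
  θ<⇒< {0F}    {0F}    m<m = contradiction m<m (ℕ.<-irrefl refl)
  θ<⇒< {0F}    {suc j} m<j = contradiction (≤fromℕ (inject₁ j)) (ℕ.<⇒≱ m<j)
  θ<⇒< {suc i} {0F}    _   = subst (ℕ._< toℕ a) (sym (value i)) (ℕ.<-≤-trans (toℕ<n i) m≤a)
  θ<⇒< {suc i} {suc j} i<j = subst₂ ℕ._<_ (sym (value i)) (sym (value j))
                                     (subst₂ ℕ._<_ (toℕ-inject₁ i) (toℕ-inject₁ j) i<j)

cycle-Avoiders : ∀ {n m} {a : Fin (suc n)} → toℕ a ℕ.< m → Avoiders (suc n) (suc m) (cycle a)
cycle-Avoiders {a = a} a<m =
  avoids-descent p132 (s<s z<s) , avoids-descent p231 z<s , avoids-descent p321 z<s ,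
  λ c → ℕ.<⇒≱ a<m (Contains-θ⇒≤head (cycle a) (cycle-TailIncreasing a) c)
  where
  avoids-descent : (τ : Fin 3 → Fin 3) → τ 2F < τ 1F → Avoids (cycle a) τ
  avoids-descent = TailIncreasing⇒avoids-descent (cycle a) (cycle-TailIncreasing a)

FixesFrom : ∀ {n} → ℕ → Permutation′ n → Set
FixesFrom m σ = ∀ i → m ≤ toℕ i → σ ⟨$⟩ʳ i ≡ i

Avoiders⇒FixesFrom : ∀ {n m} (π : Permutation′ (suc n)) → Avoiders (suc n) (suc m) π → FixesFrom m π
Avoiders⇒FixesFrom {n} {m} π (¬132 , ¬231 , ¬321 , ¬θ) i m≤i =
  trans (π≈cycle i) (cycle-fixes a (ℕ.<-≤-trans a<m m≤i))
  where
  a : Fin (suc n)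
  a = π ⟨$⟩ʳ zero
  π≈cycle : π ≈ cycle a
  π≈cycle = TailIncreasing⇒≈cycle π (avoids⇒TailIncreasing π ¬132 ¬231 ¬321)
  a<m : toℕ a ℕ.< m
  a<m = ℕ.≰⇒> λ m≤a →
    ¬θ (Contains-resp-≈ {π = cycle a} {π} (λ j → sym (π≈cycle j)) (cycle-contains-θ a m≤a))

flip-fixes : ∀ {n} (σ : Permutation′ n) {i} → σ ⟨$⟩ʳ i ≡ i → flip σ ⟨$⟩ʳ i ≡ i
flip-fixes σ σi≡i = trans (cong (σ ⟨$⟩ˡ_) (sym σi≡i)) (inverseˡ σ)

FixesFrom-flip : ∀ {n m} (σ : Permutation′ n) → FixesFrom m σ → FixesFrom m (flip σ)
FixesFrom-flip σ fix i m≤i = flip-fixes σ (fix i m≤i)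

FixesFrom⇒<-closed : ∀ {n m} (σ : Permutation′ n) → FixesFrom m σ →
                     ∀ {i} → toℕ i ℕ.< m → toℕ (σ ⟨$⟩ʳ i) ℕ.< m
FixesFrom⇒<-closed σ fix {i} i<m = ℕ.≰⇒> λ m≤σi →
  ℕ.<⇒≱ i<m (subst (λ x → _ ≤ toℕ x) (⟨$⟩ʳ-injective σ (fix _ m≤σi)) m≤σi)

Gen⇒FixesFrom : ∀ {n m} {A : Permutation′ n → Set} → (∀ σ → A σ → FixesFrom m σ) →
                ∀ {σ} → Gen A σ → FixesFrom m σ
Gen⇒FixesFrom A⇒fix (gen {σ} a)      i m≤i = A⇒fix σ a i m≤i
Gen⇒FixesFrom A⇒fix one              i m≤i = refl
Gen⇒FixesFrom A⇒fix (mul {τ = τ} g h) i m≤i =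
  trans (cong (τ ⟨$⟩ʳ_) (Gen⇒FixesFrom A⇒fix g i m≤i)) (Gen⇒FixesFrom A⇒fix h i m≤i)
Gen⇒FixesFrom A⇒fix (inv {σ} g)      i m≤i = flip-fixes σ (Gen⇒FixesFrom A⇒fix g i m≤i)
Gen⇒FixesFrom A⇒fix (resp σ≈τ g)     i m≤i = trans (sym (σ≈τ i)) (Gen⇒FixesFrom A⇒fix g i m≤i)

transport : ∀ {n} → Fin (suc n) → Fin (suc n) → Permutation′ (suc n)
transport J v = flip (cycle J) ∘ₚ cycle v

transport-maps : ∀ {n} (J v : Fin (suc n)) → transport J v ⟨$⟩ʳ J ≡ v
transport-maps J v = cong (cycle v ⟨$⟩ʳ_) (inverseˡ (cycle J) {zero})

transport-fixes : ∀ {n} (J v : Fin (suc n)) → toℕ v ≤ toℕ J → ∀ {i} → toℕ J ℕ.< toℕ i →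
                  transport J v ⟨$⟩ʳ i ≡ i
transport-fixes J v v≤J {i} J<i = begin
  cycle v ⟨$⟩ʳ (flip (cycle J) ⟨$⟩ʳ i) ≡⟨ cong (cycle v ⟨$⟩ʳ_) (flip-fixes (cycle J) (cycle-fixes J J<i)) ⟩
  cycle v ⟨$⟩ʳ i                      ≡⟨ cycle-fixes v (ℕ.≤-<-trans v≤J J<i) ⟩
  i                                   ∎
  where open ≡-Reasoning

FixesFrom-step : ∀ {n j} (σ : Permutation′ (suc n)) (J : Fin (suc n)) → toℕ J ≡ j →
                 FixesFrom (suc j) σ → FixesFrom j (σ ∘ₚ flip (transport J (σ ⟨$⟩ʳ J)))
FixesFrom-step {n} σ J refl fix i J≤i = fixed i (ℕ.m≤n⇒m<n∨m≡n J≤i)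
  where
  v : Fin (suc n)
  v = σ ⟨$⟩ʳ J
  α : Permutation′ (suc n)
  α = transport J v
  v≤J : toℕ v ≤ toℕ J
  v≤J = ℕ.s≤s⁻¹ (FixesFrom⇒<-closed σ fix ℕ.≤-refl)
  fixed : ∀ i → toℕ J ℕ.< toℕ i ⊎ toℕ J ≡ toℕ i → flip α ⟨$⟩ʳ (σ ⟨$⟩ʳ i) ≡ i
  fixed i (inj₁ J<i) =
    trans (cong (flip α ⟨$⟩ʳ_) (fix i J<i)) (flip-fixes α (transport-fixes J v v≤J J<i))
  fixed i (inj₂ J≡i) with refl ← toℕ-injective J≡i =
    trans (cong (flip α ⟨$⟩ʳ_) (sym (transport-maps J v))) (inverseˡ α)

FixesFrom⇒Gen : ∀ {n m} {A : Permutation′ (suc n) → Set} → m ≤ suc n →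
                (∀ {a} → toℕ a ℕ.< m → A (cycle a)) → ∀ {σ} → FixesFrom m σ → Gen A σ
FixesFrom⇒Gen {n} {m} {A} m≤n cycle∈A = induct m ℕ.≤-refl
  where
  induct : ∀ j → j ≤ m → ∀ {σ} → FixesFrom j σ → Gen A σ
  induct zero    _   fix = resp (λ i → sym (fix i z≤n)) one
  induct (suc j) j<m {σ} fix =
    resp (λ x → inverseʳ α {σ ⟨$⟩ʳ x}) (mul (induct j (ℕ.<⇒≤ j<m) {σ ∘ₚ flip α} fix′) α∈⟨A⟩)
    where
    J : Fin (suc n)
    J = fromℕ< (ℕ.<-≤-trans j<m m≤n)
    J≡j : toℕ J ≡ j
    J≡j = toℕ-fromℕ< _
    α : Permutation′ (suc n)
    α = transport J (σ ⟨$⟩ʳ J)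
    fix′ : FixesFrom j (σ ∘ₚ flip α)
    fix′ = FixesFrom-step σ J J≡j fix
    J<m : toℕ J ℕ.< m
    J<m = subst (ℕ._< m) (sym J≡j) j<m
    σJ<m : toℕ (σ ⟨$⟩ʳ J) ℕ.< m
    σJ<m = ℕ.<-≤-trans (FixesFrom⇒<-closed σ fix (s≤s (ℕ.≤-reflexive J≡j))) j<m
    α∈⟨A⟩ : Gen A α
    α∈⟨A⟩ = mul (inv (gen (cycle∈A J<m))) (gen (cycle∈A σJ<m))

module _ {m d : ℕ} where

  private
    restrictFun : (σ : Permutation′ (m + d)) → FixesFrom m σ → Fin m → Fin m
    restrictFun σ fix i =
      fromℕ< (FixesFrom⇒<-closed σ fix (subst (ℕ._< m) (sym (toℕ-↑ˡ i d)) (toℕ<n i)))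

    restrictFun-↑ˡ : ∀ σ fix i → restrictFun σ fix i ↑ˡ d ≡ σ ⟨$⟩ʳ (i ↑ˡ d)
    restrictFun-↑ˡ σ fix i = toℕ-injective (trans (toℕ-↑ˡ _ d) (toℕ-fromℕ< _))

    restrictFun-inverse : ∀ σ fix τ fix′ → (∀ x → σ ⟨$⟩ʳ (τ ⟨$⟩ʳ x) ≡ x) →
                          ∀ i → restrictFun σ fix (restrictFun τ fix′ i) ≡ i
    restrictFun-inverse σ fix τ fix′ στ≗id i = ↑ˡ-injective d _ _ (begin
      restrictFun σ fix (restrictFun τ fix′ i) ↑ˡ d  ≡⟨ restrictFun-↑ˡ σ fix _ ⟩
      σ ⟨$⟩ʳ (restrictFun τ fix′ i ↑ˡ d)            ≡⟨ cong (σ ⟨$⟩ʳ_) (restrictFun-↑ˡ τ fix′ i) ⟩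
      σ ⟨$⟩ʳ (τ ⟨$⟩ʳ (i ↑ˡ d))                      ≡⟨ στ≗id (i ↑ˡ d) ⟩
      i ↑ˡ d                                       ∎)
      where open ≡-Reasoning

  restrict : (σ : Permutation′ (m + d)) → FixesFrom m σ → Permutation′ m
  restrict σ fix = permutation (restrictFun σ fix) (restrictFun (flip σ) fix⁻¹)
    (restrictFun-inverse σ fix (flip σ) fix⁻¹ (λ _ → inverseʳ σ))
    (restrictFun-inverse (flip σ) fix⁻¹ σ fix (λ _ → inverseˡ σ))
    where
    fix⁻¹ : FixesFrom m (flip σ)
    fix⁻¹ = FixesFrom-flip σ fix

  restrict-↑ˡ : ∀ σ fix i → restrict σ fix ⟨$⟩ʳ i ↑ˡ d ≡ σ ⟨$⟩ʳ (i ↑ˡ d)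
  restrict-↑ˡ = restrictFun-↑ˡ

  extend : Permutation′ m → Permutation′ (m + d)
  extend ρ = ↔-sym +↔⊎ ↔-∘ ((ρ ⊎-↔ ↔-id _) ↔-∘ +↔⊎)

  extend-↑ˡ : ∀ ρ i → extend ρ ⟨$⟩ʳ (i ↑ˡ d) ≡ ρ ⟨$⟩ʳ i ↑ˡ d
  extend-↑ˡ ρ i = cong (join m d ∘ map₁ (ρ ⟨$⟩ʳ_)) (splitAt-↑ˡ m i d)

  extend-fixes : ∀ ρ → FixesFrom m (extend ρ)
  extend-fixes ρ i m≤i = begin
    join m d (map₁ (ρ ⟨$⟩ʳ_) (splitAt m i)) ≡⟨ cong (join m d ∘ map₁ (ρ ⟨$⟩ʳ_)) (splitAt-≥ m i m≤i) ⟩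
    join m d (inj₂ _)                     ≡⟨ cong (join m d) (splitAt-≥ m i m≤i) ⟨
    join m d (splitAt m i)                ≡⟨ join-splitAt m d i ⟩
    i                                     ∎
    where open ≡-Reasoning

stabiliser-IsoToSym : ∀ {m d} {A : Permutation′ (m + d) → Set} →
                      (∀ {σ} → Gen A σ → FixesFrom m σ) → (∀ {σ} → FixesFrom m σ → Gen A σ) →
                      IsoToSym A m
stabiliser-IsoToSym {m} {d} {A} Gen⇒fix fix⇒Gen = record
  { φ      = φ
  ; φ-cong = λ {x} {y} x≈y i →
               ↑ˡ-injective d _ _ (trans (φ-↑ˡ x i) (trans (x≈y _) (sym (φ-↑ˡ y i))))
  ; φ-hom  = φ-hom
  ; φ-inj  = φ-inj
  ; φ-surj = λ ρ → let x = (extend ρ , fix⇒Gen (extend-fixes ρ)) in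
               x , λ i → ↑ˡ-injective d _ _ (trans (φ-↑ˡ x i) (extend-↑ˡ ρ i))
  }
  where
  open ≡-Reasoning
  φ : Σ (Permutation′ (m + d)) (Gen A) → Permutation′ m
  φ (σ , g) = restrict σ (Gen⇒fix g)
  φ-↑ˡ : ∀ x i → φ x ⟨$⟩ʳ i ↑ˡ d ≡ proj₁ x ⟨$⟩ʳ (i ↑ˡ d)
  φ-↑ˡ (σ , g) = restrict-↑ˡ σ (Gen⇒fix g)
  φ-hom : ∀ {σ τ} (g : Gen A σ) (h : Gen A τ) → φ (σ ∘ₚ τ , mul g h) ≈ (φ (σ , g) ∘ₚ φ (τ , h))
  φ-hom {σ} {τ} g h i = ↑ˡ-injective d _ _ (begin
    φ (σ ∘ₚ τ , mul g h) ⟨$⟩ʳ i ↑ˡ d          ≡⟨ φ-↑ˡ (σ ∘ₚ τ , mul g h) i ⟩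
    τ ⟨$⟩ʳ (σ ⟨$⟩ʳ (i ↑ˡ d))                  ≡⟨ cong (τ ⟨$⟩ʳ_) (φ-↑ˡ (σ , g) i) ⟨
    τ ⟨$⟩ʳ (φ (σ , g) ⟨$⟩ʳ i ↑ˡ d)            ≡⟨ φ-↑ˡ (τ , h) _ ⟨
    φ (τ , h) ⟨$⟩ʳ (φ (σ , g) ⟨$⟩ʳ i) ↑ˡ d     ∎)
  φ-inj : ∀ x y → φ x ≈ φ y → proj₁ x ≈ proj₁ y
  φ-inj (σ , g) (τ , h) φσ≈φτ x with splitAt m x in split
  ... | inj₁ i = begin
    σ ⟨$⟩ʳ x                     ≡⟨ cong (σ ⟨$⟩ʳ_) (splitAt⁻¹-↑ˡ split) ⟨
    σ ⟨$⟩ʳ (i ↑ˡ d)              ≡⟨ φ-↑ˡ (σ , g) i ⟨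
    φ (σ , g) ⟨$⟩ʳ i ↑ˡ d        ≡⟨ cong (_↑ˡ d) (φσ≈φτ i) ⟩
    φ (τ , h) ⟨$⟩ʳ i ↑ˡ d        ≡⟨ φ-↑ˡ (τ , h) i ⟩
    τ ⟨$⟩ʳ (i ↑ˡ d)              ≡⟨ cong (τ ⟨$⟩ʳ_) (splitAt⁻¹-↑ˡ split) ⟩
    τ ⟨$⟩ʳ x                     ∎
  ... | inj₂ j = trans (Gen⇒fix g x m≤x) (sym (Gen⇒fix h x m≤x))
    where
    m≤x : m ≤ toℕ x
    m≤x = subst (λ y → m ≤ toℕ y) (splitAt⁻¹-↑ʳ split)
                (subst (m ≤_) (sym (toℕ-↑ʳ m j)) (ℕ.m≤m+n m (toℕ j)))

theorem4p1 : (k n : ℕ) → 2 ≤ k → k ≤ n → IsoToSym (Avoiders n k) (k ∸ 1)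
theorem4p1 (suc (suc m)) n (s≤s (s≤s z≤n)) k≤n with d , refl ← ℕ.m≤n⇒∃[o]m+o≡n (ℕ.<⇒≤ k≤n) =
  stabiliser-IsoToSym (Gen⇒FixesFrom Avoiders⇒FixesFrom)
                      (FixesFrom⇒Gen (ℕ.m≤m+n (suc m) d) cycle-Avoiders)
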